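{- For all $n\ge1$, $Z(\widehat{G}_n)\ge \frac{4}{9}|V(\widehat{G}_n)|$, where $\widehat{G}_n$ is the connected graph of maximum degree $3$ defined in the context.
   Context: Zero forcing: given a graph and a set $S$ of initially black vertices (all others white), repeatedly apply the rule: if a black vertex $v$ has exactly one white neighbor $u$, then $u$ becomes black (and stays black). $S$ is a zero forcing set if every vertex eventually becomes black. $Z(G)$ is the minimum size of a zero forcing set of $G$. Construction: for $d\ge1$, let $B_d$ be the complete binary tree on $2^d-1$ vertices with root $r$ ($B_1$ is a single vertex; for $d>1$ the root has two children which are roots of copies of $B_{d-1}$). A subdivided $K_4$ is the graph obtained from $K_4$ on vertices $a,b,c,e$ by subdividing the edge $ab$ with a new vertex $\ell$. For $n\ge1$, $G_n$ is obtained from $B_{2n-1}$ by attaching to every leaf $\ell$ of $B_{2n-1}$ a private copy of the subdivided $K_4$ in which $\ell$ plays the role of the subdividing vertex (i.e. add new vertices $a,b,c,e$ with edges $\ell a,\ell b,ac,ae,bc,be,ce$). Let $r_n$ denote the root of $B_{2n-1}$. The graph $\widehat{G}_n$ is obtained from $G_n$ by adding a new vertex $y_n$ adjacent only to $r_n$. -}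

module Defs where

open import Data.Nat using (ℕ; zero; suc; _+_; _*_; _^_; _≤_; _<_)
open import Data.Fin using (Fin; toℕ)
open import Data.Fin.Subset using (Subset; _∈_; _∉_; _∪_; ⁅_⁆; ⊤)
open import Data.Product using (∃; _×_; _,_)
open import Data.Sum using (_⊎_)
open import Relation.Binary.PropositionalEquality using (_≡_)
open import Relation.Binary.Construct.Closure.ReflexiveTransitive using (Star)

record Graph : Set₁ where
  field
    N   : ℕ
    Adj : Fin N → Fin N → Set
open Graph public

data Force (G : Graph) : Subset (N G) → Subset (N G) → Set where
  force : ∀ {S} (v u : Fin (N G)) →
          v ∈ S → u ∉ S → Adj G v u →
          (∀ w → Adj G v w → w ∉ S → w ≡ u) →
          Force G S (S ∪ ⁅ u ⁆)

IsZeroForcingSet : (G : Graph) → Subset (N G) → Set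
IsZeroForcingSet G S = Star (Force G) S ⊤

-- The graph Ĝ_n, with vertices labelled by natural numbers:
--   d = 2n-1, L = 2^(d-1) = 4^(n-1) leaves of B_d, T = 2^d - 1 = 2L - 1.
--   0          : the extra vertex y_n
--   1 .. T     : B_d in heap order (root r_n = 1, children of i are 2i, 2i+1);
--                leaves are L .. 2L-1, leaf L + j for j < L
--   2L+4j+k    : the vertices a,b,c,e (k = 0,1,2,3) of the subdivided K₄
--                attached to leaf L + j.
-- Total number of vertices: 1 + T + 4L = 6L.

leaves : ℕ → ℕ
leaves n = 4 ^ n          -- L for Ĝ_(n+1), i.e. 2^(2(n+1)-1-1)

data Edge (n : ℕ) : ℕ → ℕ → Set where
  e-yr    : Edge n 0 1
  e-left  : ∀ i → 1 ≤ i → i < leaves n → Edge n i (2 * i)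
  e-right : ∀ i → 1 ≤ i → i < leaves n → Edge n i (suc (2 * i))
  e-ℓa    : ∀ j → j < leaves n → Edge n (leaves n + j) (2 * leaves n + 4 * j)
  e-ℓb    : ∀ j → j < leaves n → Edge n (leaves n + j) (2 * leaves n + 4 * j + 1)
  e-ac    : ∀ j → j < leaves n → Edge n (2 * leaves n + 4 * j) (2 * leaves n + 4 * j + 2)
  e-ae    : ∀ j → j < leaves n → Edge n (2 * leaves n + 4 * j) (2 * leaves n + 4 * j + 3)
  e-bc    : ∀ j → j < leaves n → Edge n (2 * leaves n + 4 * j + 1) (2 * leaves n + 4 * j + 2)
  e-be    : ∀ j → j < leaves n → Edge n (2 * leaves n + 4 * j + 1) (2 * leaves n + 4 * j + 3)
  e-ce    : ∀ j → j < leaves n → Edge n (2 * leaves n + 4 * j + 2) (2 * leaves n + 4 * j + 3)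

-- Ĝ_(n+1)  (so Ĝ_m for m = n + 1 ≥ 1)
Ghat : ℕ → Graph
Ghat n = record
  { N   = 6 * leaves n
  ; Adj = λ x y → Edge n (toℕ x) (toℕ y) ⊎ Edge n (toℕ y) (toℕ x)
  }

-- Fix a zero forcing chain from S. For a tree vertex v, record whether the edge to its parent
-- (for the root r: the edge to y) was used down (the parent forced v), up (v forced its parent)
-- or not at all. In every gadget {a, b} and {c, e} are forts, and so is {ℓ, x, z} for x ∈ {a, b},
-- z ∈ {c, e}, except that ℓ may be forced from its parent; so S meets the gadget and ℓ in at least
-- two vertices, and in three unless the parent forces ℓ. Give v the potential 3·[not down] at
-- even depth and 1 + 3·[up] at odd depth. Since every vertex forces at most once and every white
-- vertex is forced by a neighbour, each internal vertex pays potential + 2 ≤ 3·[v ∈ S] + the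
-- potentials of its children, each leaf pays potential + 6 ≤ 3·|S ∩ (gadget ∪ {ℓ})|, and y pays
-- 2 ≤ 3·[y ∈ S] + potential(r). Summed over the levels the potentials telescope, leaving
-- 2 + 2(L − 1) + 6L = 8L ≤ 3|S| for L leaves, while Ĝ has 6L vertices.

module Submission where

open import Data.Nat using (ℕ; zero; suc; _+_; _*_; _^_; _≤_; _<_; z≤n; s≤s; ⌊_/2⌋; ⌈_/2⌉)
open import Data.Nat.Properties hiding (_≟_)
open import Data.Nat.Properties using () renaming (_≟_ to _≟ℕ_)
open import Data.Nat.Tactic.RingSolver using (solve-∀)
open import Algebra.Properties.CommutativeSemigroup +-commutativeSemigroup using (interchange)
open import Data.Bool using (Bool; true; false; not; _∨_; _∧_)
open import Data.Fin using (Fin; toℕ; fromℕ<; _≟_)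
import Data.Fin as Fin
open import Data.Fin.Properties using (toℕ-injective; toℕ<n; toℕ-fromℕ<; all?; any?)
open import Data.Fin.Subset using (Subset; _∈_; _∉_; _∪_; ⁅_⁆; ⊤; ∣_∣)
open import Data.Fin.Subset.Properties using (_∈?_; ∈⊤; x∈⁅x⁆; x∈⁅y⁆⇒x≡y; p⊆p∪q; q⊆p∪q; x∈p∪q⁻)
open import Data.Vec using ([]; _∷_; here; there)
open import Data.List using (List; []; _∷_)
open import Data.List.Relation.Unary.Any using (here; there)
open import Data.List.Membership.Propositional using () renaming (_∈_ to _∈ₗ_)
import Data.List.Membership.DecPropositional as DecMembership
open import Data.Product using (∃; _×_; _,_; proj₁; proj₂)
open import Data.Product.Properties using (≡-dec)
open import Data.Sum using (_⊎_; inj₁; inj₂)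
import Data.Sum as Sum
open import Data.Empty using (⊥; ⊥-elim)
open import Function using (case_of_)
open import Relation.Nullary using (¬_; Dec; yes; no; ¬?)
open import Relation.Nullary.Decidable using (_×-dec_; _⊎-dec_; _→-dec_; True; False; toWitness; toWitnessFalse)
open import Relation.Unary using (Pred; Decidable)
open import Relation.Binary.PropositionalEquality
  using (_≡_; _≢_; refl; sym; trans; subst; subst₂; cong; cong₂; module ≡-Reasoning)
open import Relation.Binary.Construct.Closure.ReflexiveTransitive using (Star; ε; _◅_)

open import Defs

-- Finite sums

∑ : ℕ → (ℕ → ℕ) → ℕ
∑ zero    f = 0
∑ (suc m) f = f 0 + ∑ m (λ i → f (suc i))

syntax ∑ m (λ i → e) = ∑[ i < m ] e

∑-cong : ∀ m {f g} → (∀ i → i < m → f i ≡ g i) → ∑ m f ≡ ∑ m g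
∑-cong zero    f≡g = refl
∑-cong (suc m) f≡g = cong₂ _+_ (f≡g 0 (s≤s z≤n)) (∑-cong m (λ i i<m → f≡g (suc i) (s≤s i<m)))

∑-mono-≤ : ∀ m {f g} → (∀ i → i < m → f i ≤ g i) → ∑ m f ≤ ∑ m g
∑-mono-≤ zero    f≤g = z≤n
∑-mono-≤ (suc m) f≤g = +-mono-≤ (f≤g 0 (s≤s z≤n)) (∑-mono-≤ m (λ i i<m → f≤g (suc i) (s≤s i<m)))

∑-distrib-+ : ∀ m f g → ∑[ i < m ] (f i + g i) ≡ ∑ m f + ∑ m g
∑-distrib-+ zero    f g = refl
∑-distrib-+ (suc m) f g =
  trans (cong (f 0 + g 0 +_) (∑-distrib-+ m _ _)) (interchange (f 0) (g 0) _ _)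

*-distribˡ-∑ : ∀ m c f → c * ∑ m f ≡ ∑[ i < m ] (c * f i)
*-distribˡ-∑ zero    c f = *-zeroʳ c
*-distribˡ-∑ (suc m) c f =
  trans (*-distribˡ-+ c (f 0) _) (cong (c * f 0 +_) (*-distribˡ-∑ m c (λ i → f (suc i))))

∑-const : ∀ m c → ∑[ i < m ] c ≡ m * c
∑-const zero    c = refl
∑-const (suc m) c = cong (c +_) (∑-const m c)

∑-split : ∀ a b f → ∑ (a + b) f ≡ ∑ a f + ∑[ i < b ] f (a + i)
∑-split zero    b f = refl
∑-split (suc a) b f = trans (cong (f 0 +_) (∑-split a b (λ i → f (suc i)))) (sym (+-assoc (f 0) _ _))

∑-last : ∀ m f → ∑ (suc m) f ≡ ∑ m f + f m
∑-last m f = begin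
  ∑ (suc m) f                     ≡⟨ cong (λ k → ∑ k f) (+-comm 1 m) ⟩
  ∑ (m + 1) f                     ≡⟨ ∑-split m 1 f ⟩
  ∑ m f + (f (m + 0) + 0)         ≡⟨ cong (λ x → ∑ m f + x) (trans (+-identityʳ _) (cong f (+-identityʳ m))) ⟩
  ∑ m f + f m                     ∎
  where open ≡-Reasoning

∑-blocks : ∀ k M f → ∑ (k * M) f ≡ ∑[ j < M ] ∑[ r < k ] f (k * j + r)
∑-blocks k zero    f = cong (λ x → ∑ x f) (*-zeroʳ k)
∑-blocks k (suc M) f = begin
  ∑ (k * suc M) f                                          ≡⟨ cong (λ x → ∑ x f) (*-suc k M) ⟩
  ∑ (k + k * M) f                                          ≡⟨ ∑-split k (k * M) f ⟩
  ∑ k f + ∑[ i < k * M ] f (k + i)                         ≡⟨ cong₂ _+_ (∑-cong k (λ r _ → cong f (sym (+-identityˡ r))))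
                                                                       (∑-blocks k M (λ i → f (k + i))) ⟩
  ∑[ r < k ] f (0 + r) + ∑[ j < M ] ∑[ r < k ] f (k + (k * j + r))
                                                           ≡⟨ cong₂ _+_ (cong (λ x → ∑[ r < k ] f (x + r)) (sym (*-zeroʳ k)))
                                                                       (∑-cong M (λ j _ → ∑-cong k (λ r _ → cong f (shift j r)))) ⟩
  ∑[ r < k ] f (k * 0 + r) + ∑[ j < M ] ∑[ r < k ] f (k * suc j + r) ∎
  where
    open ≡-Reasoning
    shift : ∀ j r → k + (k * j + r) ≡ k * suc j + r
    shift j r = trans (sym (+-assoc k (k * j) r)) (cong (_+ r) (sym (*-suc k j)))

∑-geometric : ∀ K → 2 + ∑[ k < K ] (2 * 2 ^ k) ≡ 2 * 2 ^ K
∑-geometric zero    = refl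
∑-geometric (suc K) = begin
  2 + (2 * 1 + ∑[ k < K ] (2 * 2 ^ suc k))   ≡⟨ cong (λ x → 2 + (2 + x)) (sym (*-distribˡ-∑ K 2 (λ k → 2 * 2 ^ k))) ⟩
  2 + (2 + 2 * ∑[ k < K ] (2 * 2 ^ k))       ≡⟨ sym (*-distribˡ-+ 2 2 _) ⟩
  2 * (2 + ∑[ k < K ] (2 * 2 ^ k))           ≡⟨ cong (2 *_) (∑-geometric K) ⟩
  2 * 2 ^ suc K                              ∎
  where open ≡-Reasoning


∑-dyadic : ∀ u f → ∑ (2 ^ u) f ≡ f 0 + ∑[ k < u ] ∑[ j < 2 ^ k ] f (2 ^ k + j)
∑-dyadic zero    f = refl
∑-dyadic (suc u) f = begin
  ∑ (2 ^ suc u) f                                                  ≡⟨ cong (λ m → ∑ m f) (cong (2 ^ u +_) (+-identityʳ (2 ^ u))) ⟩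
  ∑ (2 ^ u + 2 ^ u) f                                              ≡⟨ ∑-split (2 ^ u) (2 ^ u) f ⟩
  ∑ (2 ^ u) f + level u                                            ≡⟨ cong (_+ level u) (∑-dyadic u f) ⟩
  f 0 + ∑ u level + level u                                        ≡⟨ +-assoc (f 0) _ _ ⟩
  f 0 + (∑ u level + level u)                                      ≡⟨ cong (f 0 +_) (sym (∑-last u level)) ⟩
  f 0 + ∑ (suc u) level                                            ∎
  where
    open ≡-Reasoning
    level : ℕ → ℕ
    level k = ∑[ j < 2 ^ k ] f (2 ^ k + j)

telescope : ∀ K (a b c : ℕ → ℕ) → (∀ k → k < K → a k + c k ≤ b k + a (suc k)) →
            a 0 + ∑ K c ≤ ∑ K b + a K
telescope zero    a b c step = ≤-reflexive (+-comm (a 0) 0)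
telescope (suc K) a b c step =
  +-cancelʳ-≤ (a 1) _ _ (subst₂ _≤_ (lhs (a 0) (c 0) (a 1) (∑ K _)) (rhs (b 0) (a 1) (∑ K _) (a (suc K)))
    (+-mono-≤ (step 0 (s≤s z≤n)) (telescope K (λ k → a (suc k)) (λ k → b (suc k)) (λ k → c (suc k)) (λ k k<K → step (suc k) (s≤s k<K)))))
  where
    lhs : ∀ a₀ c₀ a₁ s → a₀ + c₀ + (a₁ + s) ≡ a₀ + (c₀ + s) + a₁
    lhs = solve-∀
    rhs : ∀ b₀ a₁ s aK → b₀ + a₁ + (s + aK) ≡ b₀ + s + aK + a₁
    rhs = solve-∀

+-≤-chain : ∀ {a b c d e f g h} → a ≤ b + c → c + d ≤ e + f → f + g ≤ h → a + d + g ≤ b + e + h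
+-≤-chain {a} {b} {c} {d} {e} {f} {g} {h} h₁ h₂ h₃ =
  +-cancelʳ-≤ (c + f) _ _ (subst₂ _≤_ (lhs a c d f g) (rhs b c e f h) (+-mono-≤ (+-mono-≤ h₁ h₂) h₃))
  where
    lhs : ∀ a c d f g → a + (c + d) + (f + g) ≡ a + d + g + (c + f)
    lhs = solve-∀
    rhs : ∀ b c e f h → b + c + (e + f) + h ≡ b + e + h + (c + f)
    rhs = solve-∀

*+-injective : ∀ m j j′ {k k′} → k < m → k′ < m → m * j + k ≡ m * j′ + k′ → j ≡ j′ × k ≡ k′
*+-injective m zero    zero     _   _    e rewrite *-zeroʳ m = refl , e
*+-injective m zero    (suc j′) {k′ = k′} k<m _ e
  rewrite *-zeroʳ m | *-suc m j′ | +-assoc m (m * j′) k′ = ⊥-elim (<⇒≱ k<m (subst (m ≤_) (sym e) (m≤m+n m _)))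
*+-injective m (suc j) zero     {k = k} _ k′<m e
  rewrite *-zeroʳ m | *-suc m j | +-assoc m (m * j) k = ⊥-elim (<⇒≱ k′<m (subst (m ≤_) e (m≤m+n m _)))
*+-injective m (suc j) (suc j′) {k} {k′} k<m k′<m e
  rewrite *-suc m j | *-suc m j′ | +-assoc m (m * j) k | +-assoc m (m * j′) k′
  with *+-injective m j j′ k<m k′<m (+-cancelˡ-≡ m _ _ e)
... | refl , refl = refl , refl

𝟙 : Bool → ℕ
𝟙 true  = 1
𝟙 false = 0

∨≡true : ∀ {x y} → (x ≡ false → y ≡ false → ⊥) → x ∨ y ≡ true
∨≡true {true}          _          = refl
∨≡true {false} {true}  _          = refl
∨≡true {false} {false} both-false = ⊥-elim (both-false refl refl)

1≤𝟙∨ : ∀ x y → x ∨ y ≡ true → 1 ≤ 𝟙 x + 𝟙 y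
1≤𝟙∨ true  _    _ = s≤s z≤n
1≤𝟙∨ false true _ = s≤s z≤n

2≤𝟙∧ : ∀ x y → x ∧ y ≡ true → 2 ≤ 𝟙 x + 𝟙 y
2≤𝟙∧ true true _ = s≤s (s≤s z≤n)

∧≡false : ∀ x y → x ∧ y ≡ false → x ≡ false ⊎ y ≡ false
∧≡false true  _ e = inj₂ e
∧≡false false _ _ = inj₁ refl

evenᵇ : ℕ → Bool
evenᵇ zero    = true
evenᵇ (suc k) = not (evenᵇ k)

evenᵇ-double : ∀ n → evenᵇ (2 * n) ≡ true
evenᵇ-double zero    = refl
evenᵇ-double (suc n) rewrite +-suc n (n + 0) | evenᵇ-double n = refl

contains : ∀ {m} → Subset m → ℕ → Bool
contains []      _       = false
contains (b ∷ S) zero    = b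
contains (b ∷ S) (suc i) = contains S i

contains-∈ : ∀ {m} {S : Subset m} {x} → x ∈ S → contains S (toℕ x) ≡ true
contains-∈ here      = refl
contains-∈ (there x∈S) = contains-∈ x∈S

∣∣≡∑contains : ∀ {m} (S : Subset m) → ∣ S ∣ ≡ ∑[ i < m ] 𝟙 (contains S i)
∣∣≡∑contains []          = refl
∣∣≡∑contains (true ∷ S)  = cong suc (∣∣≡∑contains S)
∣∣≡∑contains (false ∷ S) = ∣∣≡∑contains S

-- Zero forcing

module ZeroForcing (G : Graph) where

  V : Set
  V = Fin (N G)

  Chain : Subset (N G) → Subset (N G) → Set
  Chain = Star (Force G)

  -- Forces are recorded by vertex labels, the form in which Ĝ is described.
  forces : ∀ {A B} → Chain A B → List (ℕ × ℕ)
  forces ε = []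
  forces (force v u _ _ _ _ ◅ p) = (toℕ v , toℕ u) ∷ forces p

  forced-was-white : ∀ {A B} (p : Chain A B) {a b} → (a , b) ∈ₗ forces p →
                     ∃ λ (x : V) → ∃ λ (y : V) → a ≡ toℕ x × b ≡ toℕ y × y ∉ A × Adj G x y
  forced-was-white (force v u _ u∉A vu _ ◅ p) (here refl) = v , u , refl , refl , u∉A , vu
  forced-was-white (force {S = A} v u _ _ _ _ ◅ p) (there f) with forced-was-white p f
  ... | x , y , refl , refl , y∉A∪u , xy = x , y , refl , refl , (λ y∈A → y∉A∪u (p⊆p∪q ⁅ u ⁆ y∈A)) , xy

  never-forced : ∀ {A B} (p : Chain A B) {a} (x : V) → x ∈ A → (a , toℕ x) ∈ₗ forces p → ⊥
  never-forced p x x∈A f with forced-was-white p f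
  ... | _ , y , _ , x≡y , y∉A , _ with toℕ-injective x≡y
  ... | refl = y∉A x∈A

  forcer-is-spent : ∀ {A B v u} → (∀ w → Adj G v w → w ∉ A → w ≡ u) →
                    (p : Chain (A ∪ ⁅ u ⁆) B) → ∀ {c} → (toℕ v , c) ∈ₗ forces p → ⊥
  forcer-is-spent {A} {u = u} only p f with forced-was-white p f
  ... | x , y , v≡x , refl , y∉A∪u , xy with toℕ-injective v≡x
  ... | refl with only y xy (λ y∈A → y∉A∪u (p⊆p∪q ⁅ u ⁆ y∈A))
  ... | refl = y∉A∪u (q⊆p∪q A ⁅ u ⁆ (x∈⁅x⁆ u))

  forces-once : ∀ {A B} (p : Chain A B) {a b c} → (a , b) ∈ₗ forces p → (a , c) ∈ₗ forces p → b ≡ c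
  forces-once (force v u _ _ _ _ ◅ p) (here refl) (here refl) = refl
  forces-once (force v u _ _ _ only ◅ p) (here refl) (there f) = ⊥-elim (forcer-is-spent only p f)
  forces-once (force v u _ _ _ only ◅ p) (there f) (here refl) = ⊥-elim (forcer-is-spent only p f)
  forces-once (force v u _ _ _ _ ◅ p) (there f) (there f′) = forces-once p f f′

  forces-asymmetric : ∀ {A B} (p : Chain A B) {a b} → (a , b) ∈ₗ forces p → (b , a) ∈ₗ forces p → ⊥
  forces-asymmetric (force v u v∈A u∉A _ _ ◅ p) (here refl) (here uv≡vu) with toℕ-injective (cong proj₁ uv≡vu)
  ... | refl = u∉A v∈A
  forces-asymmetric (force {S = A} v u v∈A _ _ _ ◅ p) (here refl) (there f) = never-forced p v (p⊆p∪q ⁅ u ⁆ v∈A) f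
  forces-asymmetric (force {S = A} v u v∈A _ _ _ ◅ p) (there f) (here refl) = never-forced p v (p⊆p∪q ⁅ u ⁆ v∈A) f
  forces-asymmetric (force v u _ _ _ _ ◅ p) (there f) (there f′) = forces-asymmetric p f f′

  first-force-into : ∀ {A} (p : Chain A ⊤) {w} (W : Pred ℕ w) → Decidable W →
                     (∀ (x : V) → W (toℕ x) → x ∉ A) → (x₀ : V) → W (toℕ x₀) →
                     ∃ λ (v : V) → ∃ λ (u : V) → (toℕ v , toℕ u) ∈ₗ forces p × W (toℕ u) × ¬ W (toℕ v) ×
                       Adj G v u × (∀ (x : V) → W (toℕ x) → Adj G v x → x ≡ u)
  first-force-into ε W W? white x₀ x₀∈W = ⊥-elim (white x₀ x₀∈W ∈⊤)
  first-force-into (force {S = A} v u v∈A _ vu only ◅ p) W W? white x₀ x₀∈W with W? (toℕ u)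
  ... | yes u∈W = v , u , here refl , u∈W , (λ v∈W → white v v∈W v∈A) , vu , (λ x x∈W vx → only x vx (white x x∈W))
  ... | no u∉W with first-force-into p W W? still-white x₀ x₀∈W
    where
      still-white : ∀ (x : V) → W (toℕ x) → x ∉ A ∪ ⁅ u ⁆
      still-white x x∈W x∈A∪u with x∈p∪q⁻ A ⁅ u ⁆ x∈A∪u
      ... | inj₁ x∈A = white x x∈W x∈A
      ... | inj₂ x∈u = u∉W (subst (λ y → W (toℕ y)) (x∈⁅y⁆⇒x≡y u x∈u) x∈W)
  ... | v′ , u′ , f , rest = v′ , u′ , there f , rest

-- Local counting

data Orientation : Set where
  down up idle : Orientation

-- The Bool is the parity of the depth (true: even).
weight : Bool → Orientation → ℕ
weight true  down = 0
weight true  up   = 3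
weight true  idle = 3
weight false down = 1
weight false up   = 4
weight false idle = 1

weight-even≤3 : ∀ o → weight true o ≤ 3
weight-even≤3 down = z≤n
weight-even≤3 up   = ≤-refl
weight-even≤3 idle = ≤-refl

3≤weight-even : ∀ {o} → o ≢ down → 3 ≤ weight true o
3≤weight-even {down} o≢down = ⊥-elim (o≢down refl)
3≤weight-even {up}   _      = ≤-refl
3≤weight-even {idle} _      = ≤-refl

1≤weight-odd : ∀ o → 1 ≤ weight false o
1≤weight-odd down = ≤-refl
1≤weight-odd up   = s≤s z≤n
1≤weight-odd idle = ≤-refl

node-inequality :
  ∀ even {black} x y z →
  (white-forced : black ≡ false → x ≡ up ⊎ y ≡ up ⊎ z ≡ down) →
  (not-both-children : ¬ (x ≡ down × y ≡ down)) →
  (forcing-up : z ≡ up → x ≢ down × y ≢ down) →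
  weight even z + 2 ≤ 3 * 𝟙 black + (weight (not even) x + weight (not even) y)
node-inequality true {true} x y z _ _ _ =
  +-mono-≤ (weight-even≤3 z) (+-mono-≤ (1≤weight-odd x) (1≤weight-odd y))
node-inequality true {false} x y z white-forced _ _ with white-forced refl
... | inj₁ refl = ≤-trans (+-monoˡ-≤ 2 (weight-even≤3 z)) (+-monoʳ-≤ 4 (1≤weight-odd y))
... | inj₂ (inj₁ refl) =
  ≤-trans (+-monoˡ-≤ 2 (weight-even≤3 z)) (≤-trans (+-monoʳ-≤ 4 (1≤weight-odd x)) (≤-reflexive (+-comm 4 _)))
... | inj₂ (inj₂ refl) = +-mono-≤ (1≤weight-odd x) (1≤weight-odd y)
node-inequality false {black} x y up _ _ forcing-up with forcing-up refl
... | x≢down , y≢down = ≤-trans (+-mono-≤ (3≤weight-even x≢down) (3≤weight-even y≢down)) (m≤n+m _ (3 * 𝟙 black))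
node-inequality false {true} x y down _ _ _ = m≤m+n 3 _
node-inequality false {true} x y idle _ _ _ = m≤m+n 3 _
node-inequality false {false} x y idle white-forced _ _ with white-forced refl
... | inj₁ refl        = m≤m+n 3 _
... | inj₂ (inj₁ refl) = m≤n+m 3 _
node-inequality false {false} down y down _ not-both _ = 3≤weight-even (λ y≡down → not-both (refl , y≡down))
node-inequality false {false} up   y down _ _        _ = m≤m+n 3 _
node-inequality false {false} idle y down _ _        _ = m≤m+n 3 _

gadget-black≥3 : ∀ ℓ {a b c e} → a ∨ b ≡ true → c ∨ e ≡ true →
                 (ℓ ≡ false → a ≡ false ⊎ b ≡ false → c ≡ false ⊎ e ≡ false → ⊥) →
                 3 ≤ 𝟙 ℓ + ((𝟙 a + 𝟙 b) + (𝟙 c + 𝟙 e))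
gadget-black≥3 true {a} {b} {c} {e} ab ce _ = s≤s (+-mono-≤ (1≤𝟙∨ a b ab) (1≤𝟙∨ c e ce))
gadget-black≥3 false {a} {b} {c} {e} ab ce not-all-white with a ∧ b in ab-black | c ∧ e in ce-black
... | true  | _     = +-mono-≤ (2≤𝟙∧ a b ab-black) (1≤𝟙∨ c e ce)
... | false | true  = +-mono-≤ (1≤𝟙∨ a b ab) (2≤𝟙∧ c e ce-black)
... | false | false = ⊥-elim (not-all-white refl (∧≡false a b ab-black) (∧≡false c e ce-black))

leaf-inequality : ∀ {ℓ a b c e} o → a ∨ b ≡ true → c ∨ e ≡ true →
                  (parent-forces : ℓ ≡ false → a ≡ false ⊎ b ≡ false → c ≡ false ⊎ e ≡ false → o ≡ down) →
                  weight true o + 6 ≤ 3 * (𝟙 ℓ + ((𝟙 a + 𝟙 b) + (𝟙 c + 𝟙 e)))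
leaf-inequality {ℓ} {a} {b} {c} {e} down ab ce _ = *-monoʳ-≤ 3 (≤-trans (+-mono-≤ (1≤𝟙∨ a b ab) (1≤𝟙∨ c e ce)) (m≤n+m _ (𝟙 ℓ)))
leaf-inequality {ℓ} up   ab ce parent-forces =
  *-monoʳ-≤ 3 (gadget-black≥3 ℓ ab ce (λ w₁ w₂ w₃ → case parent-forces w₁ w₂ w₃ of λ ()))
leaf-inequality {ℓ} idle ab ce parent-forces =
  *-monoʳ-≤ 3 (gadget-black≥3 ℓ ab ce (λ w₁ w₂ w₃ → case parent-forces w₁ w₂ w₃ of λ ()))

orient : ∀ {A B : Set} → Dec A → Dec B → Orientation
orient (yes _) _       = down
orient (no _)  (yes _) = up
orient (no _)  (no _)  = idle

module _ {A B : Set} where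

  orient-down : ∀ {A? : Dec A} {B? : Dec B} → A → orient A? B? ≡ down
  orient-down {yes _} _ = refl
  orient-down {no ¬a} a = ⊥-elim (¬a a)

  orient-up : ∀ {A? : Dec A} {B? : Dec B} → ¬ A → B → orient A? B? ≡ up
  orient-up {yes a} ¬a _ = ⊥-elim (¬a a)
  orient-up {no _} {yes _} _ _ = refl
  orient-up {no _} {no ¬b} _ b = ⊥-elim (¬b b)

  orient-down⁻ : ∀ {A? : Dec A} {B? : Dec B} → orient A? B? ≡ down → A
  orient-down⁻ {yes a} _ = a
  orient-down⁻ {no _} {yes _} ()
  orient-down⁻ {no _} {no _} ()

  orient-up⁻ : ∀ {A? : Dec A} {B? : Dec B} → orient A? B? ≡ up → B
  orient-up⁻ {yes _} ()
  orient-up⁻ {no _} {yes b} _ = b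
  orient-up⁻ {no _} {no _} ()

-- The gadget and the graph Ĝ

Pos : Set
Pos = Fin 5

pattern pℓ = Fin.zero
pattern pa = Fin.suc Fin.zero
pattern pb = Fin.suc (Fin.suc Fin.zero)
pattern pc = Fin.suc (Fin.suc (Fin.suc Fin.zero))
pattern pe = Fin.suc (Fin.suc (Fin.suc (Fin.suc Fin.zero)))

open DecMembership (≡-dec (_≟_ {5}) (_≟_ {5})) using () renaming (_∈?_ to _∈ₗ?_)

gadgetEdges : List (Pos × Pos)
gadgetEdges = (pℓ , pa) ∷ (pℓ , pb) ∷ (pa , pc) ∷ (pa , pe) ∷ (pb , pc) ∷ (pb , pe) ∷ (pc , pe) ∷ []

GadgetAdj : Pos → Pos → Set
GadgetAdj p q = (p , q) ∈ₗ gadgetEdges ⊎ (q , p) ∈ₗ gadgetEdges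

gadgetAdj? : ∀ p q → Dec (GadgetAdj p q)
gadgetAdj? p q = ((p , q) ∈ₗ? gadgetEdges) ⊎-dec ((q , p) ∈ₗ? gadgetEdges)

-- The fort condition inside a gadget; the only edge leaving a gadget joins ℓ to its parent.
IsGadgetFort : Subset 5 → Set
IsGadgetFort W = ∀ p q → GadgetAdj p q → q ∈ W → p ∉ W → ∃ λ q′ → q′ ∈ W × GadgetAdj p q′ × q′ ≢ q

isGadgetFort? : ∀ W → Dec (IsGadgetFort W)
isGadgetFort? W =
  all? λ p → all? λ q → gadgetAdj? p q →-dec q ∈? W →-dec ¬? (p ∈? W) →-dec
    any? λ q′ → q′ ∈? W ×-dec gadgetAdj? p q′ ×-dec ¬? (q′ ≟ q)

Child : ℕ → ℕ → Set
Child i c = c ≡ 2 * i ⊎ c ≡ suc (2 * i)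

⌊child/2⌋ : ∀ {i c} → Child i c → ⌊ c /2⌋ ≡ i
⌊child/2⌋ {i} (inj₁ refl) = trans (cong ⌊_/2⌋ (cong (i +_) (+-identityʳ i))) (sym (n≡⌊n+n/2⌋ i))
⌊child/2⌋ {i} (inj₂ refl) = trans (cong ⌈_/2⌉ (cong (i +_) (+-identityʳ i))) (sym (n≡⌈n+n/2⌉ i))

parent≤child : ∀ {i c} → Child i c → i ≤ c
parent≤child {i} (inj₁ refl) = m≤m+n i _
parent≤child {i} (inj₂ refl) = m≤n⇒m≤1+n (m≤m+n i _)

module HatG (n : ℕ) where

  L : ℕ
  L = leaves n

  1≤L : 1 ≤ L
  1≤L = m^n>0 4 n

  Adjℕ : ℕ → ℕ → Set
  Adjℕ a b = Edge n a b ⊎ Edge n b a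

  vertex : ℕ → Pos → ℕ
  vertex j pℓ = L + j
  vertex j pa = 2 * L + 4 * j
  vertex j pb = 2 * L + 4 * j + 1
  vertex j pc = 2 * L + 4 * j + 2
  vertex j pe = 2 * L + 4 * j + 3

  vertex-suc : ∀ j k → vertex j (Fin.suc k) ≡ 2 * L + (4 * j + toℕ k)
  vertex-suc j Fin.zero = trans (sym (+-identityʳ _)) (+-assoc (2 * L) (4 * j) 0)
  vertex-suc j (Fin.suc Fin.zero) = +-assoc (2 * L) (4 * j) 1
  vertex-suc j (Fin.suc (Fin.suc Fin.zero)) = +-assoc (2 * L) (4 * j) 2
  vertex-suc j (Fin.suc (Fin.suc (Fin.suc Fin.zero))) = +-assoc (2 * L) (4 * j) 3

  leaf<2L : ∀ {j} → j < L → L + j < 2 * L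
  leaf<2L {j} j<L = subst (L + j <_) (cong (L +_) (sym (+-identityʳ L))) (+-monoʳ-< L j<L)

  2L≤vertex-suc : ∀ j k → 2 * L ≤ vertex j (Fin.suc k)
  2L≤vertex-suc j k = subst (2 * L ≤_) (sym (vertex-suc j k)) (m≤m+n (2 * L) _)

  L≤vertex : ∀ j p → L ≤ vertex j p
  L≤vertex j pℓ = m≤m+n L j
  L≤vertex j (Fin.suc k) = ≤-trans (m≤m+n L _) (2L≤vertex-suc j k)

  vertex<6L : ∀ {j} p → j < L → vertex j p < 6 * L
  vertex<6L pℓ j<L = <-≤-trans (leaf<2L j<L) (*-monoˡ-≤ L {2} {6} (s≤s (s≤s z≤n)))
  vertex<6L {j} (Fin.suc k) j<L = begin-strict
    vertex j (Fin.suc k)      ≡⟨ vertex-suc j k ⟩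
    2 * L + (4 * j + toℕ k)   <⟨ +-monoʳ-< (2 * L) (+-monoʳ-< (4 * j) (toℕ<n k)) ⟩
    2 * L + (4 * j + 4)       ≡⟨ cong (2 * L +_) (trans (+-comm (4 * j) 4) (sym (*-suc 4 j))) ⟩
    2 * L + 4 * suc j         ≤⟨ +-monoʳ-≤ (2 * L) (*-monoʳ-≤ 4 j<L) ⟩
    2 * L + 4 * L             ≡⟨ sym (*-distribʳ-+ L 2 4) ⟩
    6 * L                     ∎
    where open ≤-Reasoning

  vertex-injective : ∀ {j j′} p q → j < L → j′ < L → vertex j p ≡ vertex j′ q → j ≡ j′ × p ≡ q
  vertex-injective pℓ pℓ _ _ e = +-cancelˡ-≡ L _ _ e , refl
  vertex-injective {j} {j′} pℓ (Fin.suc k) j<L _ e = ⊥-elim (<⇒≱ (leaf<2L j<L) (subst (2 * L ≤_) (sym e) (2L≤vertex-suc j′ k)))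
  vertex-injective {j} {j′} (Fin.suc k) pℓ _ j′<L e = ⊥-elim (<⇒≱ (leaf<2L j′<L) (subst (2 * L ≤_) e (2L≤vertex-suc j k)))
  vertex-injective {j} {j′} (Fin.suc k) (Fin.suc k′) _ _ e
    with *+-injective 4 j j′ (toℕ<n k) (toℕ<n k′)
           (+-cancelˡ-≡ (2 * L) _ _ (trans (sym (vertex-suc j k)) (trans e (vertex-suc j′ k′))))
  ... | refl , k≡k′ = refl , cong Fin.suc (toℕ-injective k≡k′)

  data EdgeView : ℕ → ℕ → Set where
    root-edge   : EdgeView 0 1
    tree-edge   : ∀ {i c} → 1 ≤ i → i < L → Child i c → EdgeView i c
    gadget-edge : ∀ {j p q} → j < L → (p , q) ∈ₗ gadgetEdges → EdgeView (vertex j p) (vertex j q)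

  edgeView : ∀ {a b} → Edge n a b → EdgeView a b
  edgeView e-yr              = root-edge
  edgeView (e-left i 1≤i i<L)  = tree-edge 1≤i i<L (inj₁ refl)
  edgeView (e-right i 1≤i i<L) = tree-edge 1≤i i<L (inj₂ refl)
  edgeView (e-ℓa j j<L)      = gadget-edge {p = pℓ} {pa} j<L (here refl)
  edgeView (e-ℓb j j<L)      = gadget-edge {p = pℓ} {pb} j<L (there (here refl))
  edgeView (e-ac j j<L)      = gadget-edge {p = pa} {pc} j<L (there (there (here refl)))
  edgeView (e-ae j j<L)      = gadget-edge {p = pa} {pe} j<L (there (there (there (here refl))))
  edgeView (e-bc j j<L)      = gadget-edge {p = pb} {pc} j<L (there (there (there (there (here refl)))))
  edgeView (e-be j j<L)      = gadget-edge {p = pb} {pe} j<L (there (there (there (there (there (here refl))))))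
  edgeView (e-ce j j<L)      = gadget-edge {p = pc} {pe} j<L (there (there (there (there (there (there (here refl)))))))

  Adjacent : ℕ → ℕ → Set
  Adjacent a b = EdgeView a b ⊎ EdgeView b a

  adjacent : ∀ {a b} → Adjℕ a b → Adjacent a b
  adjacent = Sum.map edgeView edgeView

  gadget-edge-sound : ∀ {j p q} → j < L → (p , q) ∈ₗ gadgetEdges → Edge n (vertex j p) (vertex j q)
  gadget-edge-sound {j} j<L (here refl) = e-ℓa j j<L
  gadget-edge-sound {j} j<L (there (here refl)) = e-ℓb j j<L
  gadget-edge-sound {j} j<L (there (there (here refl))) = e-ac j j<L
  gadget-edge-sound {j} j<L (there (there (there (here refl)))) = e-ae j j<L
  gadget-edge-sound {j} j<L (there (there (there (there (here refl))))) = e-bc j j<L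
  gadget-edge-sound {j} j<L (there (there (there (there (there (here refl)))))) = e-be j j<L
  gadget-edge-sound {j} j<L (there (there (there (there (there (there (here refl))))))) = e-ce j j<L

  gadgetAdj-sound : ∀ {j p q} → j < L → GadgetAdj p q → Adjℕ (vertex j p) (vertex j q)
  gadgetAdj-sound j<L (inj₁ pq) = inj₁ (gadget-edge-sound j<L pq)
  gadgetAdj-sound j<L (inj₂ qp) = inj₂ (gadget-edge-sound j<L qp)

  child<2L : ∀ {i c} → i < L → Child i c → c < 2 * L
  child<2L {i} i<L (inj₁ refl) = <-trans (n<1+n (2 * i)) (child<2L i<L (inj₂ refl))
  child<2L {i} i<L (inj₂ refl) = subst (_≤ 2 * L) (*-suc 2 i) (*-monoʳ-≤ 2 i<L)

  neighbour-of-gadget : ∀ {j q w x} → j < L → x ≡ vertex j q → Adjacent w x →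
                        (∃ λ p → w ≡ vertex j p × GadgetAdj p q) ⊎ (q ≡ pℓ × w ≡ ⌊ x /2⌋)
  neighbour-of-gadget {q = pℓ} _ _ (inj₁ root-edge) = inj₂ (refl , refl)
  neighbour-of-gadget {j} {Fin.suc k} _ x≡ (inj₁ root-edge) =
    ⊥-elim (<⇒≱ (*-monoʳ-≤ 2 1≤L) (subst (2 * L ≤_) (sym x≡) (2L≤vertex-suc j k)))
  neighbour-of-gadget {q = pℓ} _ x≡ (inj₁ (tree-edge _ _ c)) = inj₂ (refl , sym (⌊child/2⌋ c))
  neighbour-of-gadget {j} {Fin.suc k} _ x≡ (inj₁ (tree-edge _ i<L c)) =
    ⊥-elim (<⇒≱ (child<2L i<L c) (subst (2 * L ≤_) (sym x≡) (2L≤vertex-suc j k)))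
  neighbour-of-gadget {q = q} j<L x≡ (inj₁ (gadget-edge {p = p} {q′} j′<L pq′))
    with vertex-injective q′ q j′<L j<L x≡
  ... | refl , refl = inj₁ (p , refl , inj₁ pq′)
  neighbour-of-gadget {j} {q} _ x≡ (inj₂ root-edge) = ⊥-elim (<⇒≱ 1≤L (subst (L ≤_) (sym x≡) (L≤vertex j q)))
  neighbour-of-gadget {j} {q} _ x≡ (inj₂ (tree-edge _ i<L _)) = ⊥-elim (<⇒≱ i<L (subst (L ≤_) (sym x≡) (L≤vertex j q)))
  neighbour-of-gadget {q = q} j<L x≡ (inj₂ (gadget-edge {p = p} {q′} j′<L pq′))
    with vertex-injective p q j′<L j<L x≡
  ... | refl , refl = inj₁ (q′ , refl , inj₂ pq′)

  neighbour-of-internal : ∀ {i w} → 1 ≤ i → i < L → Adjacent w i → w ≡ ⌊ i /2⌋ ⊎ Child i w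
  neighbour-of-internal _ _ (inj₁ root-edge) = inj₁ refl
  neighbour-of-internal _ _ (inj₁ (tree-edge _ _ c)) = inj₁ (sym (⌊child/2⌋ c))
  neighbour-of-internal _ i<L (inj₁ (gadget-edge {j} {q = q} _ _)) = ⊥-elim (<⇒≱ i<L (L≤vertex j q))
  neighbour-of-internal () _ (inj₂ root-edge)
  neighbour-of-internal _ _ (inj₂ (tree-edge _ _ c)) = inj₂ c
  neighbour-of-internal _ i<L (inj₂ (gadget-edge {j} {p} _ _)) = ⊥-elim (<⇒≱ i<L (L≤vertex j p))

  neighbour-of-y : ∀ {w x} → x ≡ 0 → Adjacent w x → w ≡ 1
  neighbour-of-y () (inj₁ root-edge)
  neighbour-of-y refl (inj₁ (tree-edge 1≤i _ c)) = ⊥-elim (<⇒≱ 1≤i (parent≤child c))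
  neighbour-of-y x≡0 (inj₁ (gadget-edge {j} {q = q} _ _)) = ⊥-elim (<⇒≱ 1≤L (subst (L ≤_) x≡0 (L≤vertex j q)))
  neighbour-of-y _ (inj₂ root-edge) = refl
  neighbour-of-y refl (inj₂ (tree-edge () _ _))
  neighbour-of-y x≡0 (inj₂ (gadget-edge {j} {p} _ _)) = ⊥-elim (<⇒≱ 1≤L (subst (L ≤_) x≡0 (L≤vertex j p)))

-- A zero forcing chain of Ĝ

module ForcingChain (n : ℕ) (S : Subset (6 * leaves n)) (chain : Star (Force (Ghat n)) S ⊤) where
  open ZeroForcing (Ghat n)
  open HatG n
  open DecMembership (≡-dec _≟ℕ_ _≟ℕ_) using () renaming (_∈?_ to _∈ℕ?_)

  infix 4 _⇒_
  _⇒_ : ℕ → ℕ → Set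
  a ⇒ b = (a , b) ∈ₗ forces chain

  black : ℕ → Bool
  black = contains S

  -- How the edge from i to its parent ⌊ i /2⌋ is used; the parent of the root 1 is y = 0.
  orientation : ℕ → Orientation
  orientation i = orient ((⌊ i /2⌋ , i) ∈ℕ? forces chain) ((i , ⌊ i /2⌋) ∈ℕ? forces chain)

  forces-parent⇒up : ∀ i → i ⇒ ⌊ i /2⌋ → orientation i ≡ up
  forces-parent⇒up i f = orient-up (λ f′ → forces-asymmetric chain f′ f) f

  child-forces⇒up : ∀ {v c} → Child v c → c ⇒ v → orientation c ≡ up
  child-forces⇒up {c = c} child f = forces-parent⇒up c (subst (c ⇒_) (sym (⌊child/2⌋ child)) f)

  down⇒parent-forces : ∀ {v c} → Child v c → orientation c ≡ down → v ⇒ c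
  down⇒parent-forces child d = subst (_⇒ _) (⌊child/2⌋ child) (orient-down⁻ d)

  L≤6L : L ≤ 6 * L
  L≤6L = m≤n*m L 6

  white-forced-by-neighbour : ∀ {a} → a < 6 * L → black a ≡ false → ∃ λ w → w ⇒ a × Adjℕ w a
  white-forced-by-neighbour {a} a<6L a-white
    with first-force-into chain (_≡ a) (_≟ℕ a) white (fromℕ< a<6L) (toℕ-fromℕ< a<6L)
    where
      white : ∀ x → toℕ x ≡ a → x ∉ S
      white x refl x∈S = case trans (sym (contains-∈ x∈S)) a-white of λ ()
  ... | v , u , f , refl , _ , vu , _ = toℕ v , f , vu

  white-internal-is-forced : ∀ {v} → 1 ≤ v → v < L → black v ≡ false →
    orientation (2 * v) ≡ up ⊎ orientation (suc (2 * v)) ≡ up ⊎ orientation v ≡ down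
  white-internal-is-forced 1≤v v<L v-white with white-forced-by-neighbour (<-≤-trans v<L L≤6L) v-white
  ... | w , f , wv with neighbour-of-internal 1≤v v<L (adjacent wv)
  ...   | inj₁ refl        = inj₂ (inj₂ (orient-down f))
  ...   | inj₂ (inj₁ refl) = inj₁ (child-forces⇒up (inj₁ refl) f)
  ...   | inj₂ (inj₂ refl) = inj₂ (inj₁ (child-forces⇒up (inj₂ refl) f))

  children-not-both-down : ∀ v → ¬ (orientation (2 * v) ≡ down × orientation (suc (2 * v)) ≡ down)
  children-not-both-down v (d₁ , d₂) =
    <-irrefl (forces-once chain (down⇒parent-forces {v} (inj₁ refl) d₁) (down⇒parent-forces {v} (inj₂ refl) d₂)) (n<1+n (2 * v))

  up⇒no-child-down : ∀ {v c} → 1 ≤ v → Child v c → orientation v ≡ up → orientation c ≢ down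
  up⇒no-child-down {suc v} _ child u d =
    <-irrefl (forces-once chain (orient-up⁻ u) (down⇒parent-forces child d)) (<-≤-trans (⌊n/2⌋<n v) (parent≤child child))

  white-y⇒root-up : black 0 ≡ false → orientation 1 ≡ up
  white-y⇒root-up y-white with white-forced-by-neighbour (<-≤-trans 1≤L L≤6L) y-white
  ... | w , f , w0 with neighbour-of-y refl (adjacent w0)
  ... | refl = forces-parent⇒up 1 f

  InGadget : ℕ → Subset 5 → ℕ → Set
  InGadget j W x = ∃ λ p → p ∈ W × x ≡ vertex j p

  inGadget? : ∀ j W → Decidable (InGadget j W)
  inGadget? j W x = any? λ p → p ∈? W ×-dec x ≟ℕ vertex j p

  vertexᶠ : ∀ {j} → j < L → Pos → Fin (6 * L)
  vertexᶠ j<L p = fromℕ< (vertex<6L p j<L)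

  fort-entered-from-parent : ∀ {j} → j < L → ∀ W → IsGadgetFort W →
                             (∀ p → p ∈ W → black (vertex j p) ≡ false) → ∀ q₀ → q₀ ∈ W →
                             pℓ ∈ W × ⌊ vertex j pℓ /2⌋ ⇒ vertex j pℓ
  fort-entered-from-parent {j} j<L W fort white q₀ q₀∈W
    with first-force-into chain (InGadget j W) (inGadget? j W) white′ (vertexᶠ j<L q₀) (q₀ , q₀∈W , toℕ-fromℕ< _)
    where
      white′ : ∀ x → InGadget j W (toℕ x) → x ∉ S
      white′ x (p , p∈W , x≡) x∈S = case trans (sym (contains-∈ x∈S)) (subst (λ i → black i ≡ false) (sym x≡) (white p p∈W)) of λ ()
  ... | v , u , f , (q , q∈W , u≡) , v∉W , vu , only with neighbour-of-gadget {q = q} j<L u≡ (adjacent vu)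
  ...   | inj₂ (refl , v≡) = q∈W , subst₂ _⇒_ (trans v≡ (cong ⌊_/2⌋ u≡)) u≡ f
  ...   | inj₁ (p , v≡ , pq) with p ∈? W
  ...     | yes p∈W = ⊥-elim (v∉W (p , p∈W , v≡))
  ...     | no p∉W with fort p q pq q∈W p∉W
  ...       | q′ , q′∈W , pq′ , q′≢q = ⊥-elim (q′≢q (proj₂ (vertex-injective q′ q j<L j<L same-vertex)))
    where
      w′ : Fin (6 * L)
      w′ = vertexᶠ j<L q′
      vw′ : Adjℕ (toℕ v) (toℕ w′)
      vw′ = subst₂ Adjℕ (sym v≡) (sym (toℕ-fromℕ< _)) (gadgetAdj-sound j<L pq′)
      same-vertex : vertex j q′ ≡ vertex j q
      same-vertex = trans (sym (toℕ-fromℕ< _)) (trans (cong toℕ (only w′ (q′ , q′∈W , toℕ-fromℕ< _) vw′)) u≡)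

  pair : Pos → Pos → Subset 5
  pair x y = ⁅ x ⁆ ∪ ⁅ y ⁆

  ∈pair⁻ : ∀ {p} x y → p ∈ pair x y → p ≡ x ⊎ p ≡ y
  ∈pair⁻ x y p∈ = Sum.map (x∈⁅y⁆⇒x≡y x) (x∈⁅y⁆⇒x≡y y) (x∈p∪q⁻ ⁅ x ⁆ ⁅ y ⁆ p∈)

  pair-white : ∀ {j} x y → black (vertex j x) ≡ false → black (vertex j y) ≡ false →
               ∀ p → p ∈ pair x y → black (vertex j p) ≡ false
  pair-white x y x-white y-white p p∈ with ∈pair⁻ x y p∈
  ... | inj₁ refl = x-white
  ... | inj₂ refl = y-white

  pair-has-black : ∀ {j} → j < L → ∀ x y → {True (isGadgetFort? (pair x y))} → {False (pℓ ∈? pair x y)} →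
                   black (vertex j x) ∨ black (vertex j y) ≡ true
  pair-has-black j<L x y {fort} {ℓ∉} = ∨≡true λ x-white y-white →
    toWitnessFalse ℓ∉ (proj₁ (fort-entered-from-parent j<L (pair x y) (toWitness fort)
                                (pair-white x y x-white y-white) x (p⊆p∪q ⁅ y ⁆ (x∈⁅x⁆ x))))

  leaf-forced-by-parent : ∀ {j} → j < L → ∀ x y → {True (isGadgetFort? (⁅ pℓ ⁆ ∪ pair x y))} →
                          black (vertex j pℓ) ≡ false → black (vertex j x) ≡ false → black (vertex j y) ≡ false →
                          orientation (vertex j pℓ) ≡ down
  leaf-forced-by-parent {j} j<L x y {fort} ℓ-white x-white y-white =
    orient-down (proj₂ (fort-entered-from-parent j<L _ (toWitness fort) white pℓ (p⊆p∪q (pair x y) (x∈⁅x⁆ pℓ))))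
    where
      white : ∀ p → p ∈ ⁅ pℓ ⁆ ∪ pair x y → black (vertex j p) ≡ false
      white p p∈ = Sum.[ (λ p∈ℓ → subst (λ q → black (vertex j q) ≡ false) (sym (x∈⁅y⁆⇒x≡y pℓ p∈ℓ)) ℓ-white)
                       , pair-white x y x-white y-white p ] (x∈p∪q⁻ ⁅ pℓ ⁆ (pair x y) p∈)

  gadgetBlack : ℕ → ℕ
  gadgetBlack j = (𝟙 (black (vertex j pa)) + 𝟙 (black (vertex j pb))) + (𝟙 (black (vertex j pc)) + 𝟙 (black (vertex j pe)))

  leaf-bound : ∀ {j} → j < L → weight true (orientation (L + j)) + 6 ≤ 3 * (𝟙 (black (L + j)) + gadgetBlack j)
  leaf-bound {j} j<L = leaf-inequality _ (pair-has-black j<L pa pb) (pair-has-black j<L pc pe) parent-forces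
    where
      parent-forces : black (L + j) ≡ false →
                      black (vertex j pa) ≡ false ⊎ black (vertex j pb) ≡ false →
                      black (vertex j pc) ≡ false ⊎ black (vertex j pe) ≡ false →
                      orientation (L + j) ≡ down
      parent-forces ℓ-white (inj₁ a-white) (inj₁ c-white) = leaf-forced-by-parent j<L pa pc ℓ-white a-white c-white
      parent-forces ℓ-white (inj₁ a-white) (inj₂ e-white) = leaf-forced-by-parent j<L pa pe ℓ-white a-white e-white
      parent-forces ℓ-white (inj₂ b-white) (inj₁ c-white) = leaf-forced-by-parent j<L pb pc ℓ-white b-white c-white
      parent-forces ℓ-white (inj₂ b-white) (inj₂ e-white) = leaf-forced-by-parent j<L pb pe ℓ-white b-white e-white

  node-bound : ∀ k {v} → 1 ≤ v → v < L →
               weight (evenᵇ k) (orientation v) + 2 ≤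
               3 * 𝟙 (black v) + (weight (evenᵇ (suc k)) (orientation (2 * v)) + weight (evenᵇ (suc k)) (orientation (suc (2 * v))))
  node-bound k {v} 1≤v v<L =
    node-inequality (evenᵇ k) _ _ _ (white-internal-is-forced 1≤v v<L) (children-not-both-down v)
      (λ u → up⇒no-child-down 1≤v (inj₁ refl) u , up⇒no-child-down 1≤v (inj₂ refl) u)

  K : ℕ
  K = 2 * n

  2^K≡L : 2 ^ K ≡ L
  2^K≡L = sym (^-*-assoc 2 2 n)

  potential : ℕ → ℕ
  potential k = ∑[ j < 2 ^ k ] weight (evenᵇ k) (orientation (2 ^ k + j))

  blackAt : ℕ → ℕ
  blackAt k = ∑[ j < 2 ^ k ] 𝟙 (black (2 ^ k + j))

  level-bound : ∀ k → k < K → potential k + 2 * 2 ^ k ≤ 3 * blackAt k + potential (suc k)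
  level-bound k k<K = begin
    potential k + 2 * M                                      ≡⟨ cong (potential k +_) (trans (*-comm 2 M) (sym (∑-const M 2))) ⟩
    potential k + ∑[ j < M ] 2                               ≡⟨ sym (∑-distrib-+ M _ _) ⟩
    ∑[ j < M ] (weight e (orientation (M + j)) + 2)          ≤⟨ ∑-mono-≤ M (λ j j<M → node-bound k (1≤M+ j) (M+<L j<M)) ⟩
    ∑[ j < M ] (3 * 𝟙 (black (M + j)) + children (M + j))   ≡⟨ ∑-distrib-+ M _ _ ⟩
    ∑[ j < M ] (3 * 𝟙 (black (M + j))) + ∑[ j < M ] children (M + j)
                                                             ≡⟨ cong₂ _+_ (sym (*-distribˡ-∑ M 3 _)) (sym potential-suc) ⟩
    3 * blackAt k + potential (suc k)                        ∎
    where
      open ≤-Reasoning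
      M : ℕ
      M = 2 ^ k
      e : Bool
      e = evenᵇ k
      children : ℕ → ℕ
      children v = weight (not e) (orientation (2 * v)) + weight (not e) (orientation (suc (2 * v)))
      1≤M+ : ∀ j → 1 ≤ M + j
      1≤M+ j = ≤-trans (m^n>0 2 k) (m≤m+n M j)
      M+<L : ∀ {j} → j < M → M + j < L
      M+<L {j} j<M = begin-strict
        M + j          <⟨ +-monoʳ-< M j<M ⟩
        M + M          ≡⟨ cong (M +_) (sym (+-identityʳ M)) ⟩
        2 ^ suc k      ≤⟨ ^-monoʳ-≤ 2 k<K ⟩
        2 ^ K          ≡⟨ 2^K≡L ⟩
        L              ∎
      w : ℕ → ℕ
      w i = weight (not e) (orientation i)
      left-child : ∀ j → 2 * M + (2 * j + 0) ≡ 2 * (M + j)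
      left-child j = trans (cong (2 * M +_) (+-identityʳ (2 * j))) (sym (*-distribˡ-+ 2 M j))
      right-child : ∀ j → 2 * M + (2 * j + 1) ≡ suc (2 * (M + j))
      right-child j = trans (sym (+-assoc (2 * M) (2 * j) 1)) (trans (+-comm _ 1) (cong suc (sym (*-distribˡ-+ 2 M j))))
      potential-suc : potential (suc k) ≡ ∑[ j < M ] children (M + j)
      potential-suc = trans (∑-blocks 2 M (λ i → w (2 * M + i)))
        (∑-cong M (λ j _ → cong₂ _+_ (cong w (left-child j)) (trans (+-identityʳ _) (cong w (right-child j)))))

  root-bound : 2 ≤ 3 * 𝟙 (black 0) + potential 0
  root-bound with black 0 in y-colour
  ... | true  = m≤m+n 2 _
  ... | false rewrite white-y⇒root-up y-colour = s≤s (s≤s z≤n)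

  potential-leaves : potential K ≡ ∑[ j < L ] weight true (orientation (L + j))
  potential-leaves = cong₂ (λ M e → ∑[ j < M ] weight e (orientation (M + j))) 2^K≡L (evenᵇ-double n)

  blackAt-leaves : blackAt K ≡ ∑[ j < L ] 𝟙 (black (L + j))
  blackAt-leaves = cong (λ M → ∑[ j < M ] 𝟙 (black (M + j))) 2^K≡L

  leaf-level-bound : potential K + 6 * L ≤ 3 * (blackAt K + ∑[ j < L ] gadgetBlack j)
  leaf-level-bound = begin
    potential K + 6 * L                                       ≡⟨ cong₂ _+_ potential-leaves (trans (*-comm 6 L) (sym (∑-const L 6))) ⟩
    ∑[ j < L ] weight true (orientation (L + j)) + ∑[ j < L ] 6
                                                              ≡⟨ sym (∑-distrib-+ L _ _) ⟩
    ∑[ j < L ] (weight true (orientation (L + j)) + 6)        ≤⟨ ∑-mono-≤ L (λ j j<L → leaf-bound j<L) ⟩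
    ∑[ j < L ] (3 * (𝟙 (black (L + j)) + gadgetBlack j))      ≡⟨ sym (*-distribˡ-∑ L 3 _) ⟩
    3 * ∑[ j < L ] (𝟙 (black (L + j)) + gadgetBlack j)        ≡⟨ cong (3 *_) (∑-distrib-+ L _ _) ⟩
    3 * (∑[ j < L ] 𝟙 (black (L + j)) + ∑[ j < L ] gadgetBlack j)
                                                              ≡⟨ cong (λ x → 3 * (x + ∑[ j < L ] gadgetBlack j)) (sym blackAt-leaves) ⟩
    3 * (blackAt K + ∑[ j < L ] gadgetBlack j)                ∎
    where open ≤-Reasoning

  gadget-sum : ∀ j → ∑[ r < 4 ] 𝟙 (black (2 * L + (4 * j + r))) ≡ gadgetBlack j
  gadget-sum j = trans (regroup (h 0) (h 1) (h 2) (h 3))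
                       (sym (cong₂ _+_ (cong₂ _+_ (at Fin.zero) (at (Fin.suc Fin.zero)))
                                       (cong₂ _+_ (at (Fin.suc (Fin.suc Fin.zero))) (at (Fin.suc (Fin.suc (Fin.suc Fin.zero)))))))
    where
      h : ℕ → ℕ
      h r = 𝟙 (black (2 * L + (4 * j + r)))
      at : ∀ k → 𝟙 (black (vertex j (Fin.suc k))) ≡ h (toℕ k)
      at k = cong (λ i → 𝟙 (black i)) (vertex-suc j k)
      regroup : ∀ a b c d → a + (b + (c + (d + 0))) ≡ (a + b) + (c + d)
      regroup = solve-∀

  ∣S∣≡levels+gadgets : ∣ S ∣ ≡ 𝟙 (black 0) + ∑[ k < K ] blackAt k + (blackAt K + ∑[ j < L ] gadgetBlack j)
  ∣S∣≡levels+gadgets = begin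
    ∣ S ∣                                                              ≡⟨ ∣∣≡∑contains S ⟩
    ∑[ i < 6 * L ] 𝟙 (black i)                                         ≡⟨ cong (λ m → ∑[ i < m ] 𝟙 (black i)) (*-distribʳ-+ L 2 4) ⟩
    ∑[ i < 2 * L + 4 * L ] 𝟙 (black i)                                 ≡⟨ ∑-split (2 * L) (4 * L) _ ⟩
    ∑[ i < 2 * L ] 𝟙 (black i) + ∑[ i < 4 * L ] 𝟙 (black (2 * L + i)) ≡⟨ cong₂ _+_ tree gadgets ⟩
    𝟙 (black 0) + (∑[ k < K ] blackAt k + blackAt K) + ∑[ j < L ] gadgetBlack j
                                                                       ≡⟨ regroup (𝟙 (black 0)) (∑[ k < K ] blackAt k) (blackAt K) _ ⟩
    𝟙 (black 0) + ∑[ k < K ] blackAt k + (blackAt K + ∑[ j < L ] gadgetBlack j) ∎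
    where
      open ≡-Reasoning
      tree : ∑[ i < 2 * L ] 𝟙 (black i) ≡ 𝟙 (black 0) + (∑[ k < K ] blackAt k + blackAt K)
      tree = begin
        ∑[ i < 2 * L ] 𝟙 (black i)                  ≡⟨ cong (λ m → ∑[ i < 2 * m ] 𝟙 (black i)) (sym 2^K≡L) ⟩
        ∑[ i < 2 ^ suc K ] 𝟙 (black i)              ≡⟨ ∑-dyadic (suc K) _ ⟩
        𝟙 (black 0) + ∑[ k < suc K ] blackAt k      ≡⟨ cong (𝟙 (black 0) +_) (∑-last K blackAt) ⟩
        𝟙 (black 0) + (∑[ k < K ] blackAt k + blackAt K) ∎
      gadgets : ∑[ i < 4 * L ] 𝟙 (black (2 * L + i)) ≡ ∑[ j < L ] gadgetBlack j
      gadgets = trans (∑-blocks 4 L _) (∑-cong L (λ j _ → gadget-sum j))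
      regroup : ∀ a b c d → a + (b + c) + d ≡ a + b + (c + d)
      regroup = solve-∀

  8L≤3∣S∣ : 8 * L ≤ 3 * ∣ S ∣
  8L≤3∣S∣ = subst₂ _≤_ total-demand total-supply
    (+-≤-chain {a = 2} {b = 3 * 𝟙 (black 0)} {c = potential 0} {f = potential K} {g = 6 * L}
      root-bound (telescope K potential (λ k → 3 * blackAt k) (λ k → 2 * 2 ^ k) level-bound) leaf-level-bound)
    where
      total-demand : 2 + ∑[ k < K ] (2 * 2 ^ k) + 6 * L ≡ 8 * L
      total-demand = begin
        2 + ∑[ k < K ] (2 * 2 ^ k) + 6 * L   ≡⟨ cong (_+ 6 * L) (trans (∑-geometric K) (cong (2 *_) 2^K≡L)) ⟩
        2 * L + 6 * L                         ≡⟨ sym (*-distribʳ-+ L 2 6) ⟩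
        8 * L                                 ∎
        where open ≡-Reasoning
      total-supply : 3 * 𝟙 (black 0) + ∑[ k < K ] (3 * blackAt k) + 3 * (blackAt K + ∑[ j < L ] gadgetBlack j) ≡ 3 * ∣ S ∣
      total-supply = begin
        3 * 𝟙 (black 0) + ∑[ k < K ] (3 * blackAt k) + 3 * (blackAt K + ∑[ j < L ] gadgetBlack j)
                      ≡⟨ cong (λ x → 3 * 𝟙 (black 0) + x + 3 * (blackAt K + ∑[ j < L ] gadgetBlack j)) (sym (*-distribˡ-∑ K 3 blackAt)) ⟩
        3 * 𝟙 (black 0) + 3 * ∑[ k < K ] blackAt k + 3 * (blackAt K + ∑[ j < L ] gadgetBlack j)
                      ≡⟨ factor (𝟙 (black 0)) (∑[ k < K ] blackAt k) (blackAt K + ∑[ j < L ] gadgetBlack j) ⟩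
        3 * (𝟙 (black 0) + ∑[ k < K ] blackAt k + (blackAt K + ∑[ j < L ] gadgetBlack j))
                      ≡⟨ cong (3 *_) (sym ∣S∣≡levels+gadgets) ⟩
        3 * ∣ S ∣     ∎
        where
          open ≡-Reasoning
          factor : ∀ a b c → 3 * a + 3 * b + 3 * c ≡ 3 * (a + b + c)
          factor = solve-∀

corollary1 : (n : ℕ) → (S : Subset (N (Ghat n))) → IsZeroForcingSet (Ghat n) S →
             4 * N (Ghat n) ≤ 9 * ∣ S ∣
corollary1 n S zero-forcing =
  subst₂ _≤_ (trans (sym (*-assoc 3 8 L)) (*-assoc 4 6 L)) (sym (*-assoc 3 3 ∣ S ∣))
    (*-monoʳ-≤ 3 (ForcingChain.8L≤3∣S∣ n S zero-forcing))
  where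
    L : ℕ
    L = leaves n
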